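{- Let $G_n$ ($n\ge1$) be the approximating graphs of the Diamond fractal. Then the number of spanning trees of $G_n$ is $$\tau(G_n)=2^{\frac23(4^n-1)},\qquad n\ge1.$$
   Context: Diamond fractal graphs: $G_1$ is the 4-cycle $a-u-b-v-a$ (with $a,b$ the two boundary vertices). For $n\ge2$, $G_n$ is obtained from $G_{n-1}$ by replacing every edge $\{x,y\}$ by a 4-cycle $x-u_{xy}-y-v_{xy}-x$ with two new vertices $u_{xy},v_{xy}$ (distinct for distinct edges). -}

module Defs where

open import Data.Nat using (ℕ; zero; suc; _+_; _*_; _∸_; _^_; _≤_; _<_)
open import Data.Nat.DivMod using (_/_)
open import Data.Product using (Σ; ∃; _×_; _,_)
open import Data.Sum using (_⊎_)
open import Data.Fin using (Fin)
open import Data.Fin.Subset using (Subset; _∈_)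
open import Data.List using (List; []; _∷_; _++_; [_]; length; lookup; concatMap; zip; upTo)
open import Data.List.Relation.Unary.Unique.Propositional using (Unique)
open import Data.List.Relation.Unary.Linked using (Linked)
import Data.List.Membership.Propositional as LM
open import Relation.Binary.Construct.Closure.ReflexiveTransitive using (Star)
open import Relation.Binary.PropositionalEquality using (_≡_)
open import Relation.Nullary using (¬_)

-- A finite simple graph: vertices are 0 … V-1, edges are listed (unordered pairs,
-- stored as ordered pairs in an arbitrary orientation, no duplicates).
record Graph : Set where
  constructor graph
  field
    V : ℕ
    E : List (ℕ × ℕ)
open Graph public

EdgeSet : Graph → Set
EdgeSet G = Subset (length (E G))

Adj : (G : Graph) → EdgeSet G → ℕ → ℕ → Set
Adj G S u v = ∃ λ (i : Fin (length (E G))) →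
  i ∈ S × (lookup (E G) i ≡ (u , v) ⊎ lookup (E G) i ≡ (v , u))

Connected : (G : Graph) → EdgeSet G → Set
Connected G S = ∀ u v → u < V G → v < V G → Star (Adj G S) u v

IsCycle : (G : Graph) → EdgeSet G → List ℕ → Set
IsCycle G S [] = Data.Empty.⊥
  where import Data.Empty
IsCycle G S (c ∷ cs) =
  3 ≤ length (c ∷ cs) × Unique (c ∷ cs) × Linked (Adj G S) ((c ∷ cs) ++ [ c ])

Acyclic : (G : Graph) → EdgeSet G → Set
Acyclic G S = ¬ (∃ λ cs → IsCycle G S cs)

IsSpanningTree : (G : Graph) → EdgeSet G → Set
IsSpanningTree G S = Connected G S × Acyclic G S

NumSpanningTrees : Graph → ℕ → Set
NumSpanningTrees G N = Σ (List (EdgeSet G)) λ L →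
  Unique L × length L ≡ N × (∀ S → (IsSpanningTree G S → S LM.∈ L) × (S LM.∈ L → IsSpanningTree G S))

-- Diamond construction step: edge number i = {x,y} is replaced by the 4-cycle
-- x - u - y - w - x with new vertices u = V + 2i, w = V + 2i + 1.
replaceEdge : ℕ → ℕ × ℕ → List (ℕ × ℕ)
replaceEdge base (x , y) = (x , base) ∷ (base , y) ∷ (y , suc base) ∷ (suc base , x) ∷ []

diamondStep : Graph → Graph
diamondStep (graph V E) =
  graph (V + 2 * length E)
        (concatMap (λ { (i , e) → replaceEdge (V + 2 * i) e }) (zip (upTo (length E)) E))

-- G₀ : single edge between the boundary vertices a = 0, b = 1.
-- G₁ = diamondStep G₀ is the 4-cycle a - u - b - v - a (u = 2, v = 3).
diamond : ℕ → Graph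
diamond zero = graph 2 ((0 , 1) ∷ [])
diamond (suc n) = diamondStep (diamond n)

module Submission where

-- The proof is the classical series-parallel count.  One diamond step replaces
-- each edge x–y of G by a gadget, the 4-cycle x–u–y–w–x.  A spanning tree S of
-- the new graph G' meets every gadget in one of eight admissible configurations:
-- four in which the gadget joins x to y (the 4-cycle minus one edge) and four in
-- which it does not (u and w hang separately from x or y).  Recording, for each
-- gadget, whether it joins (the collapse of S, an edge set of G) and which of its
-- four configurations it is (a code in Fin 4) is a bijection between spanning
-- trees of G' and pairs (spanning tree of G, code vector), so τ(G') = 4^|E G| τ(G).
-- Since diamond n has 4ⁿ edges, τ(diamond n) = ∏_{k<n} 4^(4^k) = 2^(2(4ⁿ-1)/3).

open import Defs
open import Data.Nat using (ℕ; zero; suc; _+_; _≤_; _<_; _∸_; _*_; _^_; z≤n; s≤s; s≤s⁻¹; _<?_)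
open import Data.Nat.Properties
  using (*-cancelˡ-≡; *-comm; *-distribˡ-+; *-monoʳ-≤; *-suc; +-cancelˡ-≡; +-monoʳ-≤; +-suc; <-trans; <-≤-trans; <⇒≢;
         ^-*-assoc; ^-distribˡ-+-*; even≢odd; m+[n∸m]≡n; m+n∸m≡n; m≤m+n; n<1+n; n≤1+n; suc-injective; ∸-monoˡ-<;
         ≤-reflexive; ≤-trans; ≮⇒≥)
open import Data.Nat.DivMod using (_/_; m*n/n≡m)
open import Data.Nat.Solver using (module +-*-Solver)
open import Data.Bool using (Bool; true; false; _∧_; _∨_)
open import Data.Fin using (Fin; zero; suc; toℕ)
import Data.Fin as Fin
open import Data.Fin.Properties using (toℕ-injective; toℕ<n)
import Data.Fin.Properties as Finₚ
open import Data.Fin.Subset using (Subset; _∈_)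
open import Data.Vec using (Vec; []; _∷_; lookup; tabulate)
import Data.Vec as Vec
open import Data.Vec.Properties using ([]=⇒lookup; lookup⇒[]=; lookup∘tabulate; tabulate∘lookup; tabulate-cong; ∷-injective; ++-injective)
open import Data.List using (List; []; _∷_; _++_; [_]; length; concatMap; zip; applyUpTo; allFin; cartesianProductWith)
import Data.List as List
open import Data.List.Properties using (length-++; length-map)
import Data.List.Membership.Propositional as LM
open import Data.List.Membership.Propositional.Properties using (∈-cartesianProductWith⁺; ∈-cartesianProductWith⁻; ∈-allFin)
open import Data.List.Membership.DecPropositional Data.Nat._≟_ using (_∈?_)
open import Data.List.Relation.Unary.Any using (here; there)
open import Data.List.Relation.Unary.All using (All; []; _∷_; head; tail)
open import Data.List.Relation.Unary.All.Properties using (¬Any⇒All¬)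
open import Data.List.Relation.Unary.AllPairs using ([]; _∷_)
open import Data.List.Relation.Unary.Unique.Propositional using (Unique)
open import Data.List.Relation.Unary.Unique.Propositional.Properties using (cartesianProductWith⁺; allFin⁺)
open import Data.List.Relation.Unary.Linked using (Linked; [-]; _∷_)
open import Data.Product using (Σ; ∃; _×_; _,_; proj₁; proj₂)
import Data.Product as Product
open import Data.Product.Properties using (,-injective)
open import Data.Sum using (_⊎_; inj₁; inj₂)
import Data.Sum as Sum
open import Data.Empty using (⊥; ⊥-elim)
open import Function using (_∘_; id)
open import Relation.Binary.PropositionalEquality using (_≡_; _≢_; refl; sym; trans; cong; cong₂; subst; module ≡-Reasoning)
open import Relation.Nullary using (¬_; yes; no)
open import Relation.Binary.Construct.Closure.ReflexiveTransitive using (Star; ε; _◅_; _◅◅_)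

Walk : (G : Graph) → EdgeSet G → ℕ → ℕ → Set
Walk G S = Star (Adj G S)

Endpoints : ℕ × ℕ → ℕ → ℕ → Set
Endpoints e p q = e ≡ (p , q) ⊎ e ≡ (q , p)

∈⇒true : ∀ {n} {S : Subset n} {i} → i ∈ S → lookup S i ≡ true
∈⇒true = []=⇒lookup

true⇒∈ : ∀ {n} {S : Subset n} {i} → lookup S i ≡ true → i ∈ S
true⇒∈ {S = S} {i} = lookup⇒[]= i S

adj-sym : ∀ G S {u v} → Adj G S u v → Adj G S v u
adj-sym G S (i , i∈S , inj₁ e) = i , i∈S , inj₂ e
adj-sym G S (i , i∈S , inj₂ e) = i , i∈S , inj₁ e

reverse : ∀ G S {u v} → Walk G S u v → Walk G S v u
reverse G S ε       = ε
reverse G S (a ◅ w) = reverse G S w ◅◅ (adj-sym G S a ◅ ε)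

widen : ∀ G {S T : EdgeSet G} → (∀ i → lookup S i ≡ true → lookup T i ≡ true) →
        ∀ {a b} → Walk G S a b → Walk G T a b
widen G S⊆T ε                  = ε
widen G S⊆T ((i , i∈S , e) ◅ w) = (i , true⇒∈ (S⊆T i (∈⇒true i∈S)) , e) ◅ widen G S⊆T w

isolated : ∀ {G S a b} → (∀ z → ¬ Adj G S a z) → Walk G S a b → a ≢ b → ⊥
isolated noEdge ε       a≢b = a≢b refl
isolated noEdge (e ◅ w) a≢b = noEdge _ e

remove : ∀ {n} → Subset n → Fin n → Subset n
remove (b ∷ S) zero    = false ∷ S
remove (b ∷ S) (suc k) = b ∷ remove S k

remove-self : ∀ {n} (S : Subset n) k → lookup (remove S k) k ≡ false
remove-self (b ∷ S) zero    = refl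
remove-self (b ∷ S) (suc k) = remove-self S k

remove-other : ∀ {n} (S : Subset n) k j → j ≢ k → lookup (remove S k) j ≡ lookup S j
remove-other (b ∷ S) zero    zero    j≢k = ⊥-elim (j≢k refl)
remove-other (b ∷ S) zero    (suc j) j≢k = refl
remove-other (b ∷ S) (suc k) zero    j≢k = refl
remove-other (b ∷ S) (suc k) (suc j) j≢k = remove-other S k j (j≢k ∘ cong suc)

remove-⊆ : ∀ {n} (S : Subset n) k j → lookup (remove S k) j ≡ true → lookup S j ≡ true × j ≢ k
remove-⊆ (b ∷ S) zero    zero    ()
remove-⊆ (b ∷ S) zero    (suc j) j∈ = j∈ , λ ()
remove-⊆ (b ∷ S) (suc k) zero    j∈ = j∈ , λ ()
remove-⊆ (b ∷ S) (suc k) (suc j) j∈ with remove-⊆ S k j j∈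
... | j∈S , j≢k = j∈S , j≢k ∘ Finₚ.suc-injective

true≢false : true ≢ false
true≢false ()

-- A path from x to y through the listed vertices (x itself is not listed).
data Path (R : ℕ → ℕ → Set) : ℕ → List ℕ → ℕ → Set where
  []  : ∀ {x} → Path R x [] x
  _∷_ : ∀ {x z vs y} → R x z → Path R z vs y → Path R x (z ∷ vs) y

mapPath : ∀ {R R' : ℕ → ℕ → Set} → (∀ {a b} → R a b → R' a b) →
          ∀ {x vs y} → Path R x vs y → Path R' x vs y
mapPath f []      = []
mapPath f (r ∷ p) = f r ∷ mapPath f p

close : ∀ {R x vs y t} → Path R x vs y → R y t → Linked R (x ∷ vs ++ [ t ])
close []      r' = r' ∷ [-]
close (r ∷ p) r' = r ∷ close p r'

SimplePath : (ℕ → ℕ → Set) → ℕ → ℕ → Set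
SimplePath R x y = Σ (List ℕ) λ vs → Path R x vs y × Unique (x ∷ vs)

shortcut : ∀ {R x z vs y} → Path R z vs y → x LM.∈ (z ∷ vs) → Unique (z ∷ vs) → SimplePath R x y
shortcut path    (here refl)  distinct       = _ , path , distinct
shortcut (r ∷ p) (there x∈vs) (_ ∷ distinct) = shortcut p x∈vs distinct

loopErase : ∀ {R x y} → Star R x y → SimplePath R x y
loopErase ε = [] , [] , ([] ∷ [])
loopErase {x = x} (_◅_ {j = z} r w) with loopErase w
... | vs , path , distinct with x ∈? (z ∷ vs)
...   | yes x∈ = shortcut path x∈ distinct
...   | no x∉  = (z ∷ vs) , (r ∷ path) , (¬Any⇒All¬ _ x∉ ∷ distinct)

Bypassed : (G : Graph) → EdgeSet G → Fin (length (E G)) → Set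
Bypassed G S k = Σ ℕ λ a → Σ ℕ λ b → List.lookup (E G) k ≡ (a , b) × Walk G (remove S k) a b

Simple : Graph → Set
Simple G = ∀ {k l : Fin (length (E G))} {p q} →
           List.lookup (E G) k ≡ (p , q) → Endpoints (List.lookup (E G) l) p q → k ≡ l

Loopless : Graph → Set
Loopless G = ∀ k → proj₁ (List.lookup (E G) k) ≢ proj₂ (List.lookup (E G) k)

endpoints-unique : ∀ {e p q a b} → Endpoints e p q → Endpoints e a b → (p ≡ a × q ≡ b) ⊎ (p ≡ b × q ≡ a)
endpoints-unique (inj₁ refl) (inj₁ refl) = inj₁ (refl , refl)
endpoints-unique (inj₁ refl) (inj₂ refl) = inj₂ (refl , refl)
endpoints-unique (inj₂ refl) (inj₁ refl) = inj₂ (refl , refl)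
endpoints-unique (inj₂ refl) (inj₂ refl) = inj₁ (refl , refl)

bypassed : ∀ G {S : EdgeSet G} {k p q} → Endpoints (List.lookup (E G) k) p q →
           Walk G (remove S k) p q → Bypassed G S k
bypassed G (inj₁ k≡pq) walk = _ , _ , k≡pq , walk
bypassed G (inj₂ k≡qp) walk = _ , _ , k≡qp , reverse G _ walk

bypass-between : ∀ G {S : EdgeSet G} {k p q} → Endpoints (List.lookup (E G) k) p q →
                 Bypassed G S k → Walk G (remove S k) p q
bypass-between G k~pq (a , b , k≡ab , walk) with endpoints-unique (inj₁ k≡ab) k~pq
... | inj₁ (refl , refl) = walk
... | inj₂ (refl , refl) = reverse G _ walk

-- In a simple loopless graph, a bypassed edge of S closes a cycle of S.  (The
-- simple path found by loop erasure has length ≥ 2, as a single step would be a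
-- second edge with the same endpoints.)
bypass⇒cycle : ∀ G (S : EdgeSet G) → Simple G → Loopless G → ∀ k → k ∈ S → Bypassed G S k → ∃ (IsCycle G S)
bypass⇒cycle G S simple loopless k k∈S (a , b , k≡ab , walk) with loopErase walk
... | [] , [] , _ = ⊥-elim (loopless k (trans (cong proj₁ k≡ab) (sym (cong proj₂ k≡ab))))
... | (z ∷ []) , ((l , l∈ , l≡ab) ∷ []) , _ =
      ⊥-elim (proj₂ (remove-⊆ S k l (∈⇒true l∈)) (sym (simple k≡ab l≡ab)))
... | (z ∷ z' ∷ vs) , path , distinct =
      (a ∷ z ∷ z' ∷ vs) , s≤s (s≤s (s≤s z≤n)) , distinct ,
      close (mapPath inS path) (k , k∈S , inj₂ k≡ab)
  where
  inS : ∀ {c d} → Adj G (remove S k) c d → Adj G S c d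
  inS (l , l∈ , e) = l , true⇒∈ (proj₁ (remove-⊆ S k l (∈⇒true l∈))) , e

acyclic⇒unbypassed : ∀ G (S : EdgeSet G) → Simple G → Loopless G → Acyclic G S → ∀ k → k ∈ S → ¬ Bypassed G S k
acyclic⇒unbypassed G S simple loopless acyclic k k∈S bypass = acyclic (bypass⇒cycle G S simple loopless k k∈S bypass)

different-edge : ∀ {e e' c₀ c₁ p q} → Endpoints e c₀ c₁ → Endpoints e' p q →
                 p ≢ c₀ → (q ≢ c₀ ⊎ p ≢ c₁) → e' ≢ e
different-edge (inj₁ refl) (inj₁ refl) p≢c₀ _              refl = p≢c₀ refl
different-edge (inj₁ refl) (inj₂ refl) _    (inj₁ q≢c₀)    refl = q≢c₀ refl
different-edge (inj₁ refl) (inj₂ refl) _    (inj₂ p≢c₁)    refl = p≢c₁ refl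
different-edge (inj₂ refl) (inj₁ refl) _    (inj₁ q≢c₀)    refl = q≢c₀ refl
different-edge (inj₂ refl) (inj₁ refl) _    (inj₂ p≢c₁)    refl = p≢c₁ refl
different-edge (inj₂ refl) (inj₂ refl) p≢c₀ _              refl = p≢c₀ refl

module CycleBypass (G : Graph) (S : EdgeSet G) (k : Fin (length (E G))) (c₀ c₁ : ℕ)
                   (k≡c₀c₁ : Endpoints (List.lookup (E G) k) c₀ c₁) where

  avoid : ∀ {p q} → Adj G S p q → p ≢ c₀ → (q ≢ c₀ ⊎ p ≢ c₁) → Adj G (remove S k) p q
  avoid (l , l∈S , e) p≢c₀ side =
    l , true⇒∈ (trans (remove-other S k l l≢k) (∈⇒true l∈S)) , e
    where
    l≢k : l ≢ k
    l≢k l≡k = different-edge k≡c₀c₁ e p≢c₀ side (cong (List.lookup (E G)) l≡k)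

  tailWalk : ∀ p qs → Linked (Adj G S) (p ∷ qs ++ [ c₀ ]) → c₀ ≢ p → c₁ ≢ p →
             All (c₀ ≢_) qs → All (c₁ ≢_) qs → Walk G (remove S k) p c₀
  tailWalk p []       (a ∷ [-]) c₀≢p c₁≢p _ _ = avoid a (c₀≢p ∘ sym) (inj₂ (c₁≢p ∘ sym)) ◅ ε
  tailWalk p (q ∷ qs) (a ∷ l)   c₀≢p c₁≢p (c₀≢q ∷ c₀∉) (c₁≢q ∷ c₁∉) =
    avoid a (c₀≢p ∘ sym) (inj₁ (c₀≢q ∘ sym)) ◅ tailWalk q qs l c₀≢q c₁≢q c₀∉ c₁∉

cycle⇒bypass : ∀ G (S : EdgeSet G) {cs} → IsCycle G S cs → Σ (Fin (length (E G))) λ k → k ∈ S × Bypassed G S k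
cycle⇒bypass G S {c₀ ∷ c₁ ∷ c₂ ∷ cs} (_ , (c₀∉ ∷ (c₁∉ ∷ _)) , ((k , k∈S , k≡c₀c₁) ∷ (step ∷ rest))) =
  k , k∈S , bypassed G k≡c₀c₁ (reverse G _ back)
  where
  open CycleBypass G S k c₀ c₁ k≡c₀c₁
  back : Walk G (remove S k) c₁ c₀
  back = avoid step (head c₀∉ ∘ sym) (inj₁ (head (tail c₀∉) ∘ sym)) ◅
         tailWalk c₂ cs rest (head (tail c₀∉)) (head c₁∉) (tail (tail c₀∉)) (tail c₁∉)
cycle⇒bypass G S {c₀ ∷ []}      (s≤s () , _)
cycle⇒bypass G S {c₀ ∷ c₁ ∷ []} (s≤s (s≤s ()) , _)

acyclic-intro : ∀ G (S : EdgeSet G) → (∀ k → k ∈ S → ¬ Bypassed G S k) → Acyclic G S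
acyclic-intro G S noBypass (cs , cycle) with cycle⇒bypass G S cycle
... | k , k∈S , bypass = noBypass k k∈S bypass

gadgets : ℕ → (ℕ → ℕ) → List (ℕ × ℕ) → List (ℕ × ℕ)
gadgets V f []       = []
gadgets V f (e ∷ es) = replaceEdge (V + 2 * f 0) e ++ gadgets V (f ∘ suc) es

diamondStep-E : ∀ V E → Graph.E (diamondStep (graph V E)) ≡ gadgets V id E
diamondStep-E V E = go id E
  where
  go : ∀ f es → concatMap (λ { (i , e) → replaceEdge (V + 2 * i) e }) (zip (applyUpTo f (length es)) es)
                ≡ gadgets V f es
  go f []       = refl
  go f (e ∷ es) = cong (replaceEdge (V + 2 * f 0) e ++_) (go (f ∘ suc) es)

length-gadgets : ∀ V f E → length (gadgets V f E) ≡ 4 * length E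
length-gadgets V f []       = refl
length-gadgets V f (e ∷ es) = trans (cong (λ t → suc (suc (suc (suc t)))) (length-gadgets V (f ∘ suc) es))
                                    (sym (*-suc 4 (length es)))

pattern j₀ = zero
pattern j₁ = suc zero
pattern j₂ = suc (suc zero)
pattern j₃ = suc (suc (suc zero))

gadgetEdge : ℕ → ℕ × ℕ → Fin 4 → ℕ × ℕ
gadgetEdge c (x , y) j₀ = (x , c)
gadgetEdge c (x , y) j₁ = (c , y)
gadgetEdge c (x , y) j₂ = (y , suc c)
gadgetEdge c (x , y) j₃ = (suc c , x)

slot : ∀ {V f} E → Fin (length E) → Fin 4 → Fin (length (gadgets V f E))
slot (e ∷ es) zero    j₀ = j₀
slot (e ∷ es) zero    j₁ = j₁
slot (e ∷ es) zero    j₂ = j₂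
slot (e ∷ es) zero    j₃ = j₃
slot (e ∷ es) (suc i) j  = suc (suc (suc (suc (slot es i j))))

position : ∀ {V f} E → Fin (length (gadgets V f E)) → Fin (length E) × Fin 4
position (e ∷ es) j₀ = zero , j₀
position (e ∷ es) j₁ = zero , j₁
position (e ∷ es) j₂ = zero , j₂
position (e ∷ es) j₃ = zero , j₃
position (e ∷ es) (suc (suc (suc (suc k)))) = Product.map₁ suc (position es k)

slot-lookup : ∀ {V f} E i j →
              List.lookup (gadgets V f E) (slot E i j) ≡ gadgetEdge (V + 2 * f (toℕ i)) (List.lookup E i) j
slot-lookup (e ∷ es) zero    j₀ = refl
slot-lookup (e ∷ es) zero    j₁ = refl
slot-lookup (e ∷ es) zero    j₂ = refl
slot-lookup (e ∷ es) zero    j₃ = refl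
slot-lookup (e ∷ es) (suc i) j  = slot-lookup es i j

position-slot : ∀ {V f} E i j → position {V} {f} E (slot E i j) ≡ (i , j)
position-slot (e ∷ es) zero    j₀ = refl
position-slot (e ∷ es) zero    j₁ = refl
position-slot (e ∷ es) zero    j₂ = refl
position-slot (e ∷ es) zero    j₃ = refl
position-slot (e ∷ es) (suc i) j  = cong (Product.map₁ suc) (position-slot es i j)

slot-injective : ∀ {V f} E {i j i' j'} → slot {V} {f} E i j ≡ slot E i' j' → i ≡ i' × j ≡ j'
slot-injective E {i} {j} {i'} {j'} eq =
  ,-injective (trans (sym (position-slot E i j)) (trans (cong (position E) eq) (position-slot E i' j')))

data SlotView {V f} E : Fin (length (gadgets V f E)) → Set where
  slotOf : ∀ i j → SlotView E (slot E i j)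

slotView : ∀ {V f} E k → SlotView {V} {f} E k
slotView (e ∷ es) j₀ = slotOf zero j₀
slotView (e ∷ es) j₁ = slotOf zero j₁
slotView (e ∷ es) j₂ = slotOf zero j₂
slotView (e ∷ es) j₃ = slotOf zero j₃
slotView (e ∷ es) (suc (suc (suc (suc k)))) with slotView es k
... | slotOf i j = slotOf (suc i) j

-- The four edges x–u, u–y, y–w, w–x of a gadget, recorded as four Booleans a b c d.
Local : Set
Local = Vec Bool 4

joins : Bool → Bool → Bool → Bool → Bool
joins a b c d = (a ∧ b) ∨ (c ∧ d)

joins-viaU : ∀ {a b} c d → a ≡ true → b ≡ true → joins a b c d ≡ true
joins-viaU c d refl refl = refl

joins-viaW : ∀ a b {c d} → c ≡ true → d ≡ true → joins a b c d ≡ true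
joins-viaW true  true  refl refl = refl
joins-viaW true  false refl refl = refl
joins-viaW false b     refl refl = refl

joins-elim : ∀ a b c d → joins a b c d ≡ true → (a ≡ true × b ≡ true) ⊎ (c ≡ true × d ≡ true)
joins-elim true  true  c     d     _  = inj₁ (refl , refl)
joins-elim true  false true  true  _  = inj₂ (refl , refl)
joins-elim false b     true  true  _  = inj₂ (refl , refl)
joins-elim true  false true  false ()
joins-elim true  false false d     ()
joins-elim false b     true  false ()
joins-elim false b     false d     ()

-- A spanning tree meets a gadget admissibly: u and w are both attached, and the
-- whole 4-cycle is not kept.
admissible : Bool → Bool → Bool → Bool → Bool
admissible false false _     _     = false
admissible _     _     false false = false
admissible true  true  true  true  = false
admissible _     _     _     _     = true

admissible-intro : ∀ a b c d → (a ≡ false → b ≡ false → ⊥) → (c ≡ false → d ≡ false → ⊥) →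
                   (a ≡ true → b ≡ true → c ≡ true → d ≡ true → ⊥) → admissible a b c d ≡ true
admissible-intro false false c     d     u w _ = ⊥-elim (u refl refl)
admissible-intro true  b     false false u w _ = ⊥-elim (w refl refl)
admissible-intro false true  false false u w _ = ⊥-elim (w refl refl)
admissible-intro true  true  true  true  u w o = ⊥-elim (o refl refl refl refl)
admissible-intro true  true  true  false u w _ = refl
admissible-intro true  true  false true  u w _ = refl
admissible-intro true  false true  d     u w _ = refl
admissible-intro true  false false true  u w _ = refl
admissible-intro false true  true  d     u w _ = refl
admissible-intro false true  false true  u w _ = refl

admissible-u : ∀ a b c d → admissible a b c d ≡ true → a ≡ true ⊎ b ≡ true
admissible-u true  b     c d _  = inj₁ refl
admissible-u false true  c d _  = inj₂ refl
admissible-u false false c d ()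

admissible-w : ∀ a b c d → admissible a b c d ≡ true → c ≡ true ⊎ d ≡ true
admissible-w a     b     true  d     _  = inj₁ refl
admissible-w a     b     false true  _  = inj₂ refl
admissible-w true  b     false false ()
admissible-w false true  false false ()
admissible-w false false false false ()

-- For each joining value there are exactly four admissible configurations:
-- the 4-cycle minus one edge, resp. u and w attached to the two ends separately.
configuration : Bool → Fin 4 → Local
configuration true  j₀ = false ∷ true  ∷ true  ∷ true  ∷ []
configuration true  j₁ = true  ∷ false ∷ true  ∷ true  ∷ []
configuration true  j₂ = true  ∷ true  ∷ false ∷ true  ∷ []
configuration true  j₃ = true  ∷ true  ∷ true  ∷ false ∷ []
configuration false j₀ = true  ∷ false ∷ false ∷ true  ∷ []
configuration false j₁ = false ∷ true  ∷ true  ∷ false ∷ []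
configuration false j₂ = true  ∷ false ∷ true  ∷ false ∷ []
configuration false j₃ = false ∷ true  ∷ false ∷ true  ∷ []

code : Bool → Bool → Bool → Bool → Fin 4
code false true  true  true  = j₀
code true  false true  true  = j₁
code true  true  false true  = j₂
code true  true  true  false = j₃
code true  false false true  = j₀
code false true  true  false = j₁
code true  false true  false = j₂
code false true  false true  = j₃
code _     _     _     _     = j₀

onLocal : ∀ {A : Set} → (Bool → Bool → Bool → Bool → A) → Local → A
onLocal f (a ∷ b ∷ c ∷ d ∷ []) = f a b c d

decode : Local → Bool × Fin 4
decode = onLocal λ a b c d → joins a b c d , code a b c d

decode-configuration : ∀ b c → decode (configuration b c) ≡ (b , c)
decode-configuration true  j₀ = refl
decode-configuration true  j₁ = refl
decode-configuration true  j₂ = refl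
decode-configuration true  j₃ = refl
decode-configuration false j₀ = refl
decode-configuration false j₁ = refl
decode-configuration false j₂ = refl
decode-configuration false j₃ = refl

configuration-admissible : ∀ b c → onLocal admissible (configuration b c) ≡ true
configuration-admissible true  j₀ = refl
configuration-admissible true  j₁ = refl
configuration-admissible true  j₂ = refl
configuration-admissible true  j₃ = refl
configuration-admissible false j₀ = refl
configuration-admissible false j₁ = refl
configuration-admissible false j₂ = refl
configuration-admissible false j₃ = refl

configuration-decode : ∀ a b c d → admissible a b c d ≡ true →
                       configuration (joins a b c d) (code a b c d) ≡ a ∷ b ∷ c ∷ d ∷ []
configuration-decode true  true  true  true  ()
configuration-decode true  true  true  false _ = refl
configuration-decode true  true  false true  _ = refl
configuration-decode true  true  false false ()
configuration-decode true  false true  true  _ = refl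
configuration-decode true  false true  false _ = refl
configuration-decode true  false false true  _ = refl
configuration-decode true  false false false ()
configuration-decode false true  true  true  _ = refl
configuration-decode false true  true  false _ = refl
configuration-decode false true  false true  _ = refl
configuration-decode false true  false false ()
configuration-decode false false c     d     ()

-- The other edge of the gadget at the same inner vertex.
partner : Fin 4 → Fin 4
partner j₀ = j₁
partner j₁ = j₀
partner j₂ = j₃
partner j₃ = j₂

partner≢ : ∀ j → partner j ≢ j
partner≢ j₀ ()
partner≢ j₁ ()
partner≢ j₂ ()
partner≢ j₃ ()

brokenAtW : ∀ c d → admissible true true c d ≡ true → c ∧ d ≡ false
brokenAtW true  true  ()
brokenAtW true  false _ = refl
brokenAtW false d     _ = refl

brokenAtU : ∀ a b → admissible a b true true ≡ true → (a ∧ b) ∨ false ≡ false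
brokenAtU true  true  ()
brokenAtU true  false _ = refl
brokenAtU false b     _ = refl

cut-joins : ∀ j (v v' : Local) → onLocal admissible v ≡ true → lookup v j ≡ true → lookup v (partner j) ≡ true →
            lookup v' j ≡ false → (∀ j' → j' ≢ j → lookup v' j' ≡ lookup v j') → onLocal joins v' ≡ false
cut-joins j₀ (_ ∷ _ ∷ c ∷ d ∷ []) (_ ∷ b' ∷ c' ∷ d' ∷ []) adm refl refl refl same
  rewrite same j₂ (λ ()) | same j₃ (λ ()) = brokenAtW c d adm
cut-joins j₁ (_ ∷ _ ∷ c ∷ d ∷ []) (a' ∷ _ ∷ c' ∷ d' ∷ []) adm refl refl refl same
  rewrite same j₀ (λ ()) | same j₂ (λ ()) | same j₃ (λ ()) = brokenAtW c d adm
cut-joins j₂ (a ∷ b ∷ _ ∷ _ ∷ []) (a' ∷ b' ∷ _ ∷ d' ∷ []) adm refl refl refl same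
  rewrite same j₀ (λ ()) | same j₁ (λ ()) = brokenAtU a b adm
cut-joins j₃ (a ∷ b ∷ _ ∷ _ ∷ []) (a' ∷ b' ∷ c' ∷ _ ∷ []) adm refl refl refl same
  rewrite same j₀ (λ ()) | same j₁ (λ ()) | same j₂ (λ ()) = brokenAtU a b adm

pointwise⇒≡ : ∀ {A : Set} {n} {xs ys : Vec A n} → (∀ k → lookup xs k ≡ lookup ys k) → xs ≡ ys
pointwise⇒≡ {xs = xs} {ys} same =
  trans (sym (tabulate∘lookup xs)) (trans (tabulate-cong same) (tabulate∘lookup ys))

expand : ∀ {V f} E → Subset (length E) → Vec (Fin 4) (length E) → Subset (length (gadgets V f E))
expand []       []      []      = []
expand {V} {f} (e ∷ es) (b ∷ T) (c ∷ cs) = configuration b c Vec.++ expand {V} {f ∘ suc} es T cs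

expand-slot : ∀ {V f} E T c i j →
              lookup (expand {V} {f} E T c) (slot E i j) ≡ lookup (configuration (lookup T i) (lookup c i)) j
expand-slot (e ∷ es) (b ∷ T) (c ∷ cs) zero    j = front (configuration b c) j
  where
  front : ∀ (v : Local) j → lookup (v Vec.++ expand es T cs) (slot (e ∷ es) zero j) ≡ lookup v j
  front (_ ∷ _ ∷ _ ∷ _ ∷ []) j₀ = refl
  front (_ ∷ _ ∷ _ ∷ _ ∷ []) j₁ = refl
  front (_ ∷ _ ∷ _ ∷ _ ∷ []) j₂ = refl
  front (_ ∷ _ ∷ _ ∷ _ ∷ []) j₃ = refl
expand-slot (e ∷ es) (b ∷ T) (c ∷ cs) (suc i) j =
  trans (back (configuration b c) (slot es i j)) (expand-slot es T cs i j)
  where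
  back : ∀ (v : Local) k → lookup (v Vec.++ expand es T cs) (suc (suc (suc (suc k)))) ≡ lookup (expand es T cs) k
  back (_ ∷ _ ∷ _ ∷ _ ∷ []) k = refl

expand-injective : ∀ {V f} E {T T' c c'} → expand {V} {f} E T c ≡ expand E T' c' → T ≡ T' × c ≡ c'
expand-injective []       {[]}    {[]}      {[]}     {[]}       _  = refl , refl
expand-injective (e ∷ es) {b ∷ T} {b' ∷ T'} {c ∷ cs} {c' ∷ cs'} eq
  with ++-injective (configuration b c) (configuration b' c') eq
... | same , rest
  with ,-injective (trans (sym (decode-configuration b c)) (trans (cong decode same) (decode-configuration b' c')))
     | expand-injective es rest
...   | refl , refl | refl , refl = refl , refl

allCodes : ∀ n → List (Vec (Fin 4) n)
allCodes zero    = [ [] ]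
allCodes (suc n) = cartesianProductWith _∷_ (allFin 4) (allCodes n)

allCodes-unique : ∀ n → Unique (allCodes n)
allCodes-unique zero    = [] ∷ []
allCodes-unique (suc n) = cartesianProductWith⁺ _∷_ ∷-injective (allFin⁺ 4) (allCodes-unique n)

allCodes-complete : ∀ n (c : Vec (Fin 4) n) → c LM.∈ allCodes n
allCodes-complete zero    []      = here refl
allCodes-complete (suc n) (a ∷ c) = ∈-cartesianProductWith⁺ _∷_ (∈-allFin a) (allCodes-complete n c)

length-cartesianProductWith : ∀ {A B C : Set} (f : A → B → C) xs ys →
                              length (cartesianProductWith f xs ys) ≡ length xs * length ys
length-cartesianProductWith f []       ys = refl
length-cartesianProductWith f (x ∷ xs) ys =
  trans (length-++ (List.map (f x) ys)) (cong₂ _+_ (length-map (f x) ys) (length-cartesianProductWith f xs ys))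

length-allCodes : ∀ n → length (allCodes n) ≡ 4 ^ n
length-allCodes zero    = refl
length-allCodes (suc n) =
  trans (length-cartesianProductWith _∷_ (allFin 4) (allCodes n)) (cong (4 *_) (length-allCodes n))

halve : ∀ {m} d → d < 2 * m → Σ (Fin m) λ i → d ≡ 2 * toℕ i ⊎ d ≡ suc (2 * toℕ i)
halve {zero}  d ()
halve {suc m} zero          _  = zero , inj₁ refl
halve {suc m} (suc zero)    _  = zero , inj₂ refl
halve {suc m} (suc (suc d)) lt with halve {m} d (s≤s⁻¹ (s≤s⁻¹ (subst (suc (suc (suc d)) ≤_) (*-suc 2 m) lt)))
... | i , inj₁ d≡ = suc i , inj₁ (trans (cong (λ t → suc (suc t)) d≡) (sym (*-suc 2 (toℕ i))))
... | i , inj₂ d≡ = suc i , inj₂ (cong suc (trans (cong suc d≡) (sym (*-suc 2 (toℕ i)))))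

record WellFormed (G : Graph) : Set where
  field
    src<     : ∀ k → proj₁ (List.lookup (E G) k) < V G
    tgt<     : ∀ k → proj₂ (List.lookup (E G) k) < V G
    loopless : Loopless G
    simple   : Simple G

endpoints-below : ∀ {e p q n} → Endpoints e p q → p < n → q < n → proj₁ e < n × proj₂ e < n
endpoints-below (inj₁ refl) p<n q<n = p<n , q<n
endpoints-below (inj₂ refl) p<n q<n = q<n , p<n

endpoints-distinct : ∀ {e p q} → Endpoints e p q → p ≢ q → proj₁ e ≢ proj₂ e
endpoints-distinct (inj₁ refl) p≢q = p≢q
endpoints-distinct (inj₂ refl) p≢q = p≢q ∘ sym

module Transfer (V : ℕ) (E : List (ℕ × ℕ)) (wf : WellFormed (graph V E)) where
  open WellFormed wf

  m : ℕ
  m = length E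

  G : Graph
  G = graph V E

  V' : ℕ
  V' = V + 2 * m

  E' : List (ℕ × ℕ)
  E' = gadgets V id E

  G' : Graph
  G' = graph V' E'

  x y u w : Fin m → ℕ
  x i = proj₁ (List.lookup E i)
  y i = proj₂ (List.lookup E i)
  u i = V + 2 * toℕ i
  w i = suc (u i)

  outer inner : Fin m → Fin 4 → ℕ
  outer i j₀ = x i
  outer i j₁ = y i
  outer i j₂ = y i
  outer i j₃ = x i
  inner i j₀ = u i
  inner i j₁ = u i
  inner i j₂ = w i
  inner i j₃ = w i

  inner-partner : ∀ i j → inner i (partner j) ≡ inner i j
  inner-partner i j₀ = refl
  inner-partner i j₁ = refl
  inner-partner i j₂ = refl
  inner-partner i j₃ = refl

  outer-partner : ∀ i j → outer i j ≢ outer i (partner j)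
  outer-partner i j₀ = loopless i
  outer-partner i j₁ = loopless i ∘ sym
  outer-partner i j₂ = loopless i ∘ sym
  outer-partner i j₃ = loopless i

  outer<V : ∀ i j → outer i j < V
  outer<V i j₀ = src< i
  outer<V i j₁ = tgt< i
  outer<V i j₂ = tgt< i
  outer<V i j₃ = src< i

  V≤inner : ∀ i j → V ≤ inner i j
  V≤inner i j₀ = m≤m+n V _
  V≤inner i j₁ = m≤m+n V _
  V≤inner i j₂ = ≤-trans (m≤m+n V _) (n≤1+n _)
  V≤inner i j₃ = ≤-trans (m≤m+n V _) (n≤1+n _)

  old≢inner : ∀ {p} i j → p < V → p ≢ inner i j
  old≢inner i j p<V = <⇒≢ (<-≤-trans p<V (V≤inner i j))

  u-injective : ∀ {i i'} → u i ≡ u i' → i ≡ i'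
  u-injective {i} {i'} e = toℕ-injective (*-cancelˡ-≡ (toℕ i) (toℕ i') 2 (+-cancelˡ-≡ V _ _ e))

  w-injective : ∀ {i i'} → w i ≡ w i' → i ≡ i'
  w-injective = u-injective ∘ suc-injective

  u≢w : ∀ i i' → u i ≢ w i'
  u≢w i i' e = even≢odd (toℕ i) (toℕ i') (+-cancelˡ-≡ V _ _ (trans e (sym (+-suc V _))))

  inner-injective : ∀ {i j i' j'} → inner i j ≡ inner i' j' → i ≡ i' × (j' ≡ j ⊎ j' ≡ partner j)
  inner-injective {j = j₀} {j' = j₀} e = u-injective e , inj₁ refl
  inner-injective {j = j₀} {j' = j₁} e = u-injective e , inj₂ refl
  inner-injective {j = j₁} {j' = j₀} e = u-injective e , inj₂ refl
  inner-injective {j = j₁} {j' = j₁} e = u-injective e , inj₁ refl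
  inner-injective {j = j₂} {j' = j₂} e = w-injective e , inj₁ refl
  inner-injective {j = j₂} {j' = j₃} e = w-injective e , inj₂ refl
  inner-injective {j = j₃} {j' = j₂} e = w-injective e , inj₂ refl
  inner-injective {j = j₃} {j' = j₃} e = w-injective e , inj₁ refl
  inner-injective {i} {j₀} {i'} {j₂} e = ⊥-elim (u≢w i i' e)
  inner-injective {i} {j₀} {i'} {j₃} e = ⊥-elim (u≢w i i' e)
  inner-injective {i} {j₁} {i'} {j₂} e = ⊥-elim (u≢w i i' e)
  inner-injective {i} {j₁} {i'} {j₃} e = ⊥-elim (u≢w i i' e)
  inner-injective {i} {j₂} {i'} {j₀} e = ⊥-elim (u≢w i' i (sym e))
  inner-injective {i} {j₂} {i'} {j₁} e = ⊥-elim (u≢w i' i (sym e))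
  inner-injective {i} {j₃} {i'} {j₀} e = ⊥-elim (u≢w i' i (sym e))
  inner-injective {i} {j₃} {i'} {j₁} e = ⊥-elim (u≢w i' i (sym e))

  w<V' : ∀ i → w i < V'
  w<V' i = ≤-trans (≤-reflexive (sym (trans (+-suc V _) (cong suc (+-suc V (2 * toℕ i))))))
                   (+-monoʳ-≤ V (≤-trans (≤-reflexive (sym (*-suc 2 (toℕ i)))) (*-monoʳ-≤ 2 (toℕ<n i))))

  inner<V' : ∀ i j → inner i j < V'
  inner<V' i j₀ = <-trans (n<1+n _) (w<V' i)
  inner<V' i j₁ = <-trans (n<1+n _) (w<V' i)
  inner<V' i j₂ = w<V' i
  inner<V' i j₃ = w<V' i

  old<V' : ∀ {p} → p < V → p < V'
  old<V' p<V = <-≤-trans p<V (m≤m+n V _)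

  classify : ∀ z → z < V' → z < V ⊎ Σ (Fin m) λ i → z ≡ u i ⊎ z ≡ w i
  classify z z<V' with z <? V
  ... | yes z<V = inj₁ z<V
  ... | no z≮V with halve (z ∸ V) (subst (z ∸ V <_) (m+n∸m≡n V (2 * m)) (∸-monoˡ-< z<V' (≮⇒≥ z≮V)))
  ...   | i , offset = inj₂ (i , Sum.map (λ e → trans z≡ (cong (V +_) e))
                                          (λ e → trans z≡ (trans (cong (V +_) e) (+-suc V _))) offset)
    where
    z≡ : z ≡ V + (z ∸ V)
    z≡ = sym (m+[n∸m]≡n (≮⇒≥ z≮V))

  gadget-shape : ∀ i j → Endpoints (gadgetEdge (u i) (List.lookup E i) j) (outer i j) (inner i j)
  gadget-shape i j₀ = inj₁ refl
  gadget-shape i j₁ = inj₂ refl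
  gadget-shape i j₂ = inj₁ refl
  gadget-shape i j₃ = inj₂ refl

  edge-shape : ∀ i j → Endpoints (List.lookup E' (slot E i j)) (outer i j) (inner i j)
  edge-shape i j = Sum.map (trans (slot-lookup E i j)) (trans (slot-lookup E i j)) (gadget-shape i j)

  wellFormed' : WellFormed G'
  wellFormed' = record { src< = src<' ; tgt< = tgt<' ; loopless = loopless' ; simple = simple' }
    where
    bounds : ∀ k → proj₁ (List.lookup E' k) < V' × proj₂ (List.lookup E' k) < V'
    bounds k with slotView E k
    ... | slotOf i j = endpoints-below (edge-shape i j) (old<V' (outer<V i j)) (inner<V' i j)
    src<' : ∀ k → proj₁ (List.lookup E' k) < V'
    src<' = proj₁ ∘ bounds
    tgt<' : ∀ k → proj₂ (List.lookup E' k) < V'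
    tgt<' = proj₂ ∘ bounds
    loopless' : Loopless G'
    loopless' k with slotView E k
    ... | slotOf i j = endpoints-distinct (edge-shape i j) (old≢inner i j (outer<V i j))
    same-edge : ∀ {i j i' j'} → outer i j ≡ outer i' j' → inner i j ≡ inner i' j' → slot {V} {id} E i j ≡ slot E i' j'
    same-edge {i} {j} {i'} {j'} o n with inner-injective {i} {j} {i'} {j'} n
    ... | refl , inj₁ refl = refl
    ... | refl , inj₂ refl = ⊥-elim (outer-partner i j o)
    simple' : Simple G'
    simple' {k} {l} {p} {q} k≡pq l~pq with slotView E k | slotView E l
    ... | slotOf i j | slotOf i' j' =
      match (endpoints-unique (inj₁ k≡pq) (edge-shape i j)) (endpoints-unique l~pq (edge-shape i' j'))
      where
      match : (p ≡ outer i j × q ≡ inner i j) ⊎ (p ≡ inner i j × q ≡ outer i j) →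
              (p ≡ outer i' j' × q ≡ inner i' j') ⊎ (p ≡ inner i' j' × q ≡ outer i' j') →
              slot E i j ≡ slot E i' j'
      match (inj₁ (refl , refl)) (inj₁ (o , n)) = same-edge o n
      match (inj₂ (refl , refl)) (inj₂ (n , o)) = same-edge o n
      match (inj₁ (refl , _))    (inj₂ (e , _)) = ⊥-elim (old≢inner i' j' (outer<V i j) e)
      match (inj₂ (_ , refl))    (inj₁ (_ , e)) = ⊥-elim (old≢inner i' j' (outer<V i j) e)

  has : EdgeSet G' → Fin m → Fin 4 → Bool
  has S i j = lookup S (slot E i j)

  local : EdgeSet G' → Fin m → Local
  local S i = tabulate (has S i)

  collapse : EdgeSet G' → Subset m
  collapse S = tabulate (λ i → proj₁ (decode (local S i)))

  codes : EdgeSet G' → Vec (Fin 4) m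
  codes S = tabulate (λ i → proj₂ (decode (local S i)))

  Admissible : EdgeSet G' → Set
  Admissible S = ∀ i → onLocal admissible (local S i) ≡ true

  collapse-lookup : ∀ S i → lookup (collapse S) i ≡ joins (has S i j₀) (has S i j₁) (has S i j₂) (has S i j₃)
  collapse-lookup S i = lookup∘tabulate _ i

  Joins : EdgeSet G' → Fin m → Set
  Joins S i = Σ (Fin 4) λ j → has S i j ≡ true × has S i (partner j) ≡ true

  joins⇒collapse : ∀ S i → Joins S i → lookup (collapse S) i ≡ true
  joins⇒collapse S i (j₀ , h , h') = trans (collapse-lookup S i) (joins-viaU (has S i j₂) (has S i j₃) h h')
  joins⇒collapse S i (j₁ , h , h') = trans (collapse-lookup S i) (joins-viaU (has S i j₂) (has S i j₃) h' h)
  joins⇒collapse S i (j₂ , h , h') = trans (collapse-lookup S i) (joins-viaW (has S i j₀) (has S i j₁) h h')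
  joins⇒collapse S i (j₃ , h , h') = trans (collapse-lookup S i) (joins-viaW (has S i j₀) (has S i j₁) h' h)

  collapse⇒joins : ∀ S i → lookup (collapse S) i ≡ true → Joins S i
  collapse⇒joins S i kept with joins-elim _ _ _ _ (trans (sym (collapse-lookup S i)) kept)
  ... | inj₁ (h₀ , h₁) = j₀ , h₀ , h₁
  ... | inj₂ (h₂ , h₃) = j₃ , h₃ , h₂

  without : EdgeSet G' → Fin m → Fin 4 → EdgeSet G'
  without S i j = remove S (slot E i j)

  has-remove : ∀ S i j i' j' → i' ≢ i ⊎ j' ≢ j → has (without S i j) i' j' ≡ has S i' j'
  has-remove S i j i' j' elsewhere = remove-other S (slot E i j) (slot E i' j') λ same →
    let i'≡i , j'≡j = slot-injective E same in Sum.[ (λ i'≢i → i'≢i i'≡i) , (λ j'≢j → j'≢j j'≡j) ] elsewhere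

  joins-remove : ∀ S i j {i'} → i' ≢ i → Joins S i' → Joins (without S i j) i'
  joins-remove S i j {i'} i'≢i (j' , h , h') =
    j' , trans (has-remove S i j i' j' (inj₁ i'≢i)) h , trans (has-remove S i j i' (partner j') (inj₁ i'≢i)) h'

  collapse-remove-other : ∀ S i j i' → i' ≢ i → lookup (collapse (without S i j)) i' ≡ lookup (collapse S) i'
  collapse-remove-other S i j i' i'≢i =
    trans (lookup∘tabulate _ i')
      (trans (cong (proj₁ ∘ decode) (tabulate-cong λ j' → has-remove S i j i' j' (inj₁ i'≢i)))
        (sym (lookup∘tabulate _ i')))

  collapse-remove-self : ∀ S i j → onLocal admissible (local S i) ≡ true → has S i j ≡ true → has S i (partner j) ≡ true →
                         lookup (collapse (without S i j)) i ≡ false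
  collapse-remove-self S i j adm h h' =
    trans (lookup∘tabulate _ i)
      (cut-joins j (local S i) (local (without S i j) i) adm (entry j h) (entry (partner j) h')
        (trans (lookup∘tabulate (has (without S i j) i) j) (remove-self S (slot E i j)))
        λ j' j'≢j → trans (lookup∘tabulate (has (without S i j) i) j')
                      (trans (has-remove S i j i j' (inj₂ j'≢j)) (sym (lookup∘tabulate (has S i) j'))))
    where
    entry : ∀ j → has S i j ≡ true → lookup (local S i) j ≡ true
    entry j = trans (lookup∘tabulate (has S i) j)

  gadgetAdj : ∀ S i j → has S i j ≡ true → Adj G' S (outer i j) (inner i j)
  gadgetAdj S i j h = slot E i j , true⇒∈ h , edge-shape i j

  GadgetStep : EdgeSet G' → ℕ → ℕ → Set
  GadgetStep S z z' = Σ (Fin m) λ i → Σ (Fin 4) λ j → has S i j ≡ true ×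
                      ((z ≡ outer i j × z' ≡ inner i j) ⊎ (z ≡ inner i j × z' ≡ outer i j))

  adj⇒gadgetStep : ∀ S {z z'} → Adj G' S z z' → GadgetStep S z z'
  adj⇒gadgetStep S (k , k∈S , k~zz') with slotView E k
  ... | slotOf i j = i , j , ∈⇒true k∈S , endpoints-unique k~zz' (edge-shape i j)

  inner-isolated : ∀ S i j → has S i j ≡ false → has S i (partner j) ≡ false → ∀ z → ¬ Adj G' S (inner i j) z
  inner-isolated S i j h h' z adj with adj⇒gadgetStep S adj
  ... | i' , j' , present , inj₁ (e , _) = old≢inner i j (outer<V i' j') (sym e)
  ... | i' , j' , present , inj₂ (e , _) with inner-injective {i} {j} {i'} {j'} e
  ...   | refl , inj₁ refl = true≢false (trans (sym present) h)
  ...   | refl , inj₂ refl = true≢false (trans (sym present) h')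

  toEdgeOrder : ∀ {W : ℕ → ℕ → Set} → (∀ {a b} → W a b → W b a) →
                ∀ i j → W (x i) (y i) → W (outer i j) (outer i (partner j))
  toEdgeOrder flip i j₀ r = r
  toEdgeOrder flip i j₁ r = flip r
  toEdgeOrder flip i j₂ r = flip r
  toEdgeOrder flip i j₃ r = r

  fromEdgeOrder : ∀ {W : ℕ → ℕ → Set} → (∀ {a b} → W a b → W b a) →
                  ∀ i j → W (outer i j) (outer i (partner j)) → W (x i) (y i)
  fromEdgeOrder flip i j₀ r = r
  fromEdgeOrder flip i j₁ r = flip r
  fromEdgeOrder flip i j₂ r = flip r
  fromEdgeOrder flip i j₃ r = r

  gadgetWalk : ∀ S i → Joins S i → Walk G' S (x i) (y i)
  gadgetWalk S i (j , h , h') = fromEdgeOrder {Walk G' S} (reverse G' S) i j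
    (gadgetAdj S i j h ◅ subst (λ z → Adj G' S z (outer i (partner j))) (inner-partner i j)
                                (adj-sym G' S (gadgetAdj S i (partner j) h')) ◅ ε)

  liftWalk : ∀ S (T : Subset m) → (∀ i → lookup T i ≡ true → Joins S i) → ∀ {a b} → Walk G T a b → Walk G' S a b
  liftWalk S T lift ε = ε
  liftWalk S T lift ((i , i∈T , inj₁ refl) ◅ walk) =
    gadgetWalk S i (lift i (∈⇒true i∈T)) ◅◅ liftWalk S T lift walk
  liftWalk S T lift ((i , i∈T , inj₂ refl) ◅ walk) =
    reverse G' S (gadgetWalk S i (lift i (∈⇒true i∈T))) ◅◅ liftWalk S T lift walk

  -- Collapsing walks of G': each vertex z of G' is shadowed by a vertex p of G,
  -- namely z itself if z is old, or an outer end of an S-edge at z if z is inner.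
  data Shadow (S : EdgeSet G') (z p : ℕ) : Set where
    self : p < V → z ≡ p → Shadow S z p
    via  : ∀ i j → has S i j ≡ true → z ≡ inner i j → p ≡ outer i j → Shadow S z p

  shadow-of-old : ∀ {S z p} → Shadow S z p → z < V → p ≡ z
  shadow-of-old (self _ z≡p)          _   = sym z≡p
  shadow-of-old (via i j _ z≡inner _) z<V = ⊥-elim (old≢inner i j z<V z≡inner)

  shadow-of-inner : ∀ {S p} i j → Shadow S (inner i j) p →
                    (has S i j ≡ true × p ≡ outer i j) ⊎ (has S i (partner j) ≡ true × p ≡ outer i (partner j))
  shadow-of-inner i j (self p<V inner≡p) = ⊥-elim (old≢inner i j p<V (sym inner≡p))
  shadow-of-inner i j (via i' j' h inner≡ p≡) with inner-injective {i} {j} {i'} {j'} inner≡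
  ... | refl , inj₁ refl = inj₁ (h , p≡)
  ... | refl , inj₂ refl = inj₂ (h , p≡)

  shadowStep : ∀ S {z z' p} → Adj G' S z z' → Shadow S z p → Σ ℕ λ p' → Shadow S z' p' × Walk G (collapse S) p p'
  shadowStep S {p = p} adj shadow with adj⇒gadgetStep S adj
  ... | i , j , h , inj₁ (refl , refl) =
    outer i j , via i j h refl refl ,
    subst (λ q → Walk G (collapse S) q (outer i j)) (sym (shadow-of-old shadow (outer<V i j))) ε
  ... | i , j , h , inj₂ (refl , refl) = outer i j , self (outer<V i j) refl , across (shadow-of-inner i j shadow)
    where
    across : (has S i j ≡ true × p ≡ outer i j) ⊎ (has S i (partner j) ≡ true × p ≡ outer i (partner j)) →
             Walk G (collapse S) p (outer i j)
    across (inj₁ (_ , refl))  = ε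
    across (inj₂ (h' , refl)) = reverse G (collapse S) (toEdgeOrder {Walk G (collapse S)} (reverse G (collapse S)) i j
      ((i , true⇒∈ (joins⇒collapse S i (j , h , h')) , inj₁ refl) ◅ ε))

  shadowWalk : ∀ S {z z' p} → Walk G' S z z' → Shadow S z p → Σ ℕ λ p' → Shadow S z' p' × Walk G (collapse S) p p'
  shadowWalk S ε shadow = _ , shadow , ε
  shadowWalk S (step ◅ walk) shadow with shadowStep S step shadow
  ... | p₁ , shadow₁ , walk₁ with shadowWalk S walk shadow₁
  ...   | p₂ , shadow₂ , walk₂ = p₂ , shadow₂ , walk₁ ◅◅ walk₂

  tree-collapses : ∀ S → IsSpanningTree G' S → Admissible S × IsSpanningTree G (collapse S)
  tree-collapses S (connected , acyclic) = admissibleS , connectedC , acyclicC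
    where
    attached : ∀ i j → has S i j ≡ false → has S i (partner j) ≡ false → ⊥
    attached i j h h' = isolated {G'} {S} (inner-isolated S i j h h')
      (connected (inner i j) (x i) (inner<V' i j) (old<V' (src< i))) (old≢inner i j (src< i) ∘ sym)

    noFourCycle : ∀ i → has S i j₀ ≡ true → has S i j₁ ≡ true → has S i j₂ ≡ true → has S i j₃ ≡ true → ⊥
    noFourCycle i h₀ h₁ h₂ h₃ = acyclic ((x i ∷ u i ∷ y i ∷ w i ∷ []) , s≤s (s≤s (s≤s z≤n)) ,
      ((old≢inner i j₀ (src< i) ∷ loopless i ∷ old≢inner i j₃ (src< i) ∷ []) ∷
       ((old≢inner i j₁ (tgt< i) ∘ sym) ∷ u≢w i i ∷ []) ∷ (old≢inner i j₂ (tgt< i) ∷ []) ∷ [] ∷ []) ,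
      (gadgetAdj S i j₀ h₀ ∷ adj-sym G' S (gadgetAdj S i j₁ h₁) ∷
       gadgetAdj S i j₂ h₂ ∷ adj-sym G' S (gadgetAdj S i j₃ h₃) ∷ [-]))

    admissibleS : Admissible S
    admissibleS i = admissible-intro _ _ _ _ (attached i j₀) (attached i j₂) (noFourCycle i)

    connectedC : Connected G (collapse S)
    connectedC a b a<V b<V with shadowWalk S (connected a b (old<V' a<V) (old<V' b<V)) (self a<V refl)
    ... | p , shadow , walk = subst (Walk G (collapse S) a) (shadow-of-old shadow b<V) walk

    -- A bypass of edge i of the collapse lifts to a bypass of a gadget edge of S.
    acyclicC : Acyclic G (collapse S)
    acyclicC = acyclic-intro G (collapse S) noBypass
      where
      noBypass : ∀ i → i ∈ collapse S → ¬ Bypassed G (collapse S) i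
      noBypass i i∈C bypass with collapse⇒joins S i (∈⇒true i∈C)
      ... | j , h , h' =
        acyclic⇒unbypassed G' S (WellFormed.simple wellFormed') (WellFormed.loopless wellFormed') acyclic
          (slot E i j) (true⇒∈ h) (bypassed G' (edge-shape i j) (lifted ◅◅ (closing ◅ ε)))
        where
        outside : ∀ i' → lookup (remove (collapse S) i) i' ≡ true → Joins (without S i j) i'
        outside i' i'∈ with remove-⊆ (collapse S) i i' i'∈
        ... | i'∈C , i'≢i = joins-remove S i j i'≢i (collapse⇒joins S i' i'∈C)
        lifted : Walk G' (without S i j) (outer i j) (outer i (partner j))
        lifted = toEdgeOrder {Walk G' (without S i j)} (reverse G' _) i j
                   (liftWalk (without S i j) (remove (collapse S) i) outside (bypass-between G (inj₁ refl) bypass))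
        closing : Adj G' (without S i j) (outer i (partner j)) (inner i j)
        closing = subst (Adj G' (without S i j) (outer i (partner j))) (inner-partner i j)
                    (gadgetAdj (without S i j) i (partner j) (trans (has-remove S i j i (partner j) (inj₂ (partner≢ j))) h'))

  tree-expands : ∀ S → Admissible S → IsSpanningTree G (collapse S) → IsSpanningTree G' S
  tree-expands S admissibleS (connectedC , acyclicC) = connected , acyclic
    where
    hang : ∀ i j → has S i j ≡ true ⊎ has S i (partner j) ≡ true → Σ ℕ λ p → p < V × Walk G' S p (inner i j)
    hang i j (inj₁ h)  = outer i j , outer<V i j , gadgetAdj S i j h ◅ ε
    hang i j (inj₂ h') = outer i (partner j) , outer<V i (partner j) ,
      subst (Walk G' S (outer i (partner j))) (inner-partner i j) (gadgetAdj S i (partner j) h' ◅ ε)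

    attach : ∀ z → z < V' → Σ ℕ λ p → p < V × Walk G' S p z
    attach z z<V' with classify z z<V'
    ... | inj₁ z<V            = z , z<V , ε
    ... | inj₂ (i , inj₁ refl) = hang i j₀ (admissible-u _ _ _ _ (admissibleS i))
    ... | inj₂ (i , inj₂ refl) = hang i j₃ (Sum.swap (admissible-w _ _ _ _ (admissibleS i)))

    connected : Connected G' S
    connected a b a<V' b<V' with attach a a<V' | attach b b<V'
    ... | p , p<V , walkᵃ | q , q<V , walkᵇ =
      reverse G' S walkᵃ ◅◅ liftWalk S (collapse S) (collapse⇒joins S) (connectedC p q p<V q<V) ◅◅ walkᵇ

    -- Removing edge j of gadget i separates inner i j from outer i j: otherwise the
    -- collapsed walk would bypass edge i of the collapse.
    cut : ∀ i j → has S i j ≡ true → ¬ Walk G' (without S i j) (outer i j) (inner i j)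
    cut i j h walk with has S i (partner j) in h'
    ... | false = isolated {G'} {without S i j} (inner-isolated (without S i j) i j (remove-self S (slot E i j))
                              (trans (has-remove S i j i (partner j) (inj₂ (partner≢ j))) h'))
                           (reverse G' _ walk) (old≢inner i j (outer<V i j) ∘ sym)
    ... | true with shadowWalk (without S i j) walk (self (outer<V i j) refl)
    ...   | p , shadow , walkᶜ with shadow-of-inner i j shadow
    ...     | inj₁ (h⁻ , _)   = true≢false (trans (sym h⁻) (remove-self S (slot E i j)))
    ...     | inj₂ (_ , refl) =
      acyclic⇒unbypassed G (collapse S) simple loopless acyclicC i (true⇒∈ (joins⇒collapse S i (j , h , h')))
        (bypassed G (inj₁ refl) (fromEdgeOrder {Walk G (remove (collapse S) i)} (reverse G _) i j (widen G inside walkᶜ)))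
      where
      inside : ∀ i' → lookup (collapse (without S i j)) i' ≡ true → lookup (remove (collapse S) i) i' ≡ true
      inside i' kept with i' Fin.≟ i
      ... | yes refl = ⊥-elim (true≢false (trans (sym kept) (collapse-remove-self S i j (admissibleS i) h h')))
      ... | no i'≢i  = trans (remove-other (collapse S) i i' i'≢i) (trans (sym (collapse-remove-other S i j i' i'≢i)) kept)

    acyclic : Acyclic G' S
    acyclic = acyclic-intro G' S noBypass
      where
      noBypass : ∀ k → k ∈ S → ¬ Bypassed G' S k
      noBypass k k∈S bypass with slotView E k
      ... | slotOf i j = cut i j (∈⇒true k∈S) (bypass-between G' (edge-shape i j) bypass)

  local-expand : ∀ T c i → local (expand E T c) i ≡ configuration (lookup T i) (lookup c i)
  local-expand T c i = pointwise⇒≡ λ j → trans (lookup∘tabulate (has (expand E T c) i) j) (expand-slot E T c i j)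

  collapse-expand : ∀ T c → collapse (expand E T c) ≡ T
  collapse-expand T c = pointwise⇒≡ λ i →
    trans (lookup∘tabulate _ i)
      (cong proj₁ (trans (cong decode (local-expand T c i)) (decode-configuration (lookup T i) (lookup c i))))

  expand-admissible : ∀ T c → Admissible (expand E T c)
  expand-admissible T c i =
    trans (cong (onLocal admissible) (local-expand T c i)) (configuration-admissible (lookup T i) (lookup c i))

  decompose : ∀ S → Admissible S → S ≡ expand E (collapse S) (codes S)
  decompose S admissibleS = pointwise⇒≡ λ k → at k (slotView E k)
    where
    at : ∀ k → SlotView E k → lookup S k ≡ lookup (expand E (collapse S) (codes S)) k
    at _ (slotOf i j) = sym (trans (expand-slot E (collapse S) (codes S) i j)
      (trans (cong₂ (λ b c → lookup (configuration b c) j) (lookup∘tabulate _ i) (lookup∘tabulate _ i))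
        (trans (cong (λ v → lookup v j) (configuration-decode _ _ _ _ (admissibleS i)))
          (lookup∘tabulate (has S i) j))))

  transfer : ∀ N → NumSpanningTrees G N → NumSpanningTrees G' (4 ^ m * N)
  transfer N (trees , unique , length≡N , complete) =
    expansions , cartesianProductWith⁺ (expand E) (expand-injective E) unique (allCodes-unique m) ,
    length≡ , λ S → expanded S , spanning S
    where
    expansions : List (EdgeSet G')
    expansions = cartesianProductWith (expand E) trees (allCodes m)

    length≡ : length expansions ≡ 4 ^ m * N
    length≡ = trans (length-cartesianProductWith (expand E) trees (allCodes m))
                (trans (cong₂ _*_ length≡N (length-allCodes m)) (*-comm N (4 ^ m)))

    expanded : ∀ S → IsSpanningTree G' S → S LM.∈ expansions
    expanded S tree with tree-collapses S tree
    ... | admissibleS , treeC = subst (LM._∈ expansions) (sym (decompose S admissibleS))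
      (∈-cartesianProductWith⁺ (expand E) (proj₁ (complete (collapse S)) treeC) (allCodes-complete m (codes S)))

    spanning : ∀ S → S LM.∈ expansions → IsSpanningTree G' S
    spanning S S∈ with ∈-cartesianProductWith⁻ (expand E) trees (allCodes m) S∈
    ... | T , c , T∈ , _ , refl = tree-expands (expand E T c) (expand-admissible T c)
      (subst (IsSpanningTree G) (sym (collapse-expand T c)) (proj₂ (complete T) T∈))

diamondStep-count : ∀ G N → WellFormed G → NumSpanningTrees G N →
                    WellFormed (diamondStep G) × NumSpanningTrees (diamondStep G) (4 ^ length (E G) * N) ×
                    length (E (diamondStep G)) ≡ 4 * length (E G)
diamondStep-count (graph V E) N wf count =
  subst Step (sym (diamondStep-E V E)) (wellFormed' , transfer N count , length-gadgets V id E)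
  where
  open Transfer V E wf
  Step : List (ℕ × ℕ) → Set
  Step E' = WellFormed (graph V' E') × NumSpanningTrees (graph V' E') (4 ^ m * N) × length E' ≡ 4 * m

single-edge : WellFormed (diamond 0) × NumSpanningTrees (diamond 0) 1
single-edge = wellFormed , [ full ] , ([] ∷ []) , refl , λ S → spanning⇒full S , full⇒spanning S
  where
  G₀ : Graph
  G₀ = diamond 0
  full empty : EdgeSet G₀
  full  = true ∷ []
  empty = false ∷ []

  wellFormed : WellFormed G₀
  wellFormed = record { src< = λ { zero → s≤s z≤n } ; tgt< = λ { zero → s≤s (s≤s z≤n) }
                      ; loopless = λ { zero () } ; simple = λ { {zero} {zero} _ _ → refl } }

  no-edge : ∀ a z → ¬ Adj G₀ empty a z
  no-edge a z (zero , () , _)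

  full-connected : Connected G₀ full
  full-connected zero          zero          _ _ = ε
  full-connected zero          (suc zero)    _ _ = (zero , Vec.here , inj₁ refl) ◅ ε
  full-connected (suc zero)    zero          _ _ = (zero , Vec.here , inj₂ refl) ◅ ε
  full-connected (suc zero)    (suc zero)    _ _ = ε
  full-connected (suc (suc a)) b             (s≤s (s≤s ())) _
  full-connected a             (suc (suc b)) _ (s≤s (s≤s ()))

  full-acyclic : Acyclic G₀ full
  full-acyclic = acyclic-intro G₀ full λ { zero _ (_ , _ , refl , walk) → isolated {G₀} {empty} (no-edge 0) walk (λ ()) }

  spanning⇒full : ∀ S → IsSpanningTree G₀ S → S LM.∈ [ full ]
  spanning⇒full (true ∷ [])  _               = here refl
  spanning⇒full (false ∷ []) (connected , _) =
    ⊥-elim (isolated {G₀} {empty} (no-edge 0) (connected 0 1 (s≤s z≤n) (s≤s (s≤s z≤n))) (λ ()))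

  full⇒spanning : ∀ S → S LM.∈ [ full ] → IsSpanningTree G₀ S
  full⇒spanning S (here refl) = full-connected , full-acyclic

-- τ n = τ(diamond n), by the recursion τ(G_{n+1}) = 4^(4ⁿ) · τ(G_n), as G_n has 4ⁿ edges.
τ : ℕ → ℕ
τ zero    = 1
τ (suc n) = 4 ^ (4 ^ n) * τ n

diamond-count : ∀ n → WellFormed (diamond n) × NumSpanningTrees (diamond n) (τ n) × length (E (diamond n)) ≡ 4 ^ n
diamond-count zero = proj₁ single-edge , proj₂ single-edge , refl
diamond-count (suc n) with diamond-count n
... | wf , count , edges with diamondStep-count (diamond n) (τ n) wf count
...   | wf' , count' , edges' =
  wf' , subst (λ e → NumSpanningTrees (diamond (suc n)) (4 ^ e * τ n)) edges count' , trans edges' (cong (4 *_) edges)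

-- Closed form: with powerSum n = 1 + 4 + … + 4ⁿ⁻¹ we have 4ⁿ = 3 · powerSum n + 1
-- and τ n = 2^(2 · powerSum n).
powerSum : ℕ → ℕ
powerSum zero    = 0
powerSum (suc n) = 4 ^ n + powerSum n

4^n≡3s+1 : ∀ n → 4 ^ n ≡ suc (powerSum n * 3)
4^n≡3s+1 zero    = refl
4^n≡3s+1 (suc n) = begin
  4 * 4 ^ n                                      ≡⟨ cong (4 *_) (4^n≡3s+1 n) ⟩
  4 * suc (powerSum n * 3)                       ≡⟨ quadruple (powerSum n) ⟩
  suc ((suc (powerSum n * 3) + powerSum n) * 3)  ≡⟨ cong (λ t → suc ((t + powerSum n) * 3)) (sym (4^n≡3s+1 n)) ⟩
  suc ((4 ^ n + powerSum n) * 3)                 ∎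
  where
  open ≡-Reasoning
  quadruple : ∀ s → 4 * suc (s * 3) ≡ suc ((suc (s * 3) + s) * 3)
  quadruple = solve 1 (λ s → con 4 :* (con 1 :+ s :* con 3) := con 1 :+ ((con 1 :+ s :* con 3) :+ s) :* con 3) refl
    where open +-*-Solver

τ≡2^2s : ∀ n → τ n ≡ 2 ^ (2 * powerSum n)
τ≡2^2s zero    = refl
τ≡2^2s (suc n) = sym (begin
  2 ^ (2 * (4 ^ n + powerSum n))          ≡⟨ cong (2 ^_) (*-distribˡ-+ 2 (4 ^ n) (powerSum n)) ⟩
  2 ^ (2 * 4 ^ n + 2 * powerSum n)        ≡⟨ ^-distribˡ-+-* 2 (2 * 4 ^ n) (2 * powerSum n) ⟩
  2 ^ (2 * 4 ^ n) * 2 ^ (2 * powerSum n)  ≡⟨ cong₂ _*_ (sym (^-*-assoc 2 2 (4 ^ n))) (sym (τ≡2^2s n)) ⟩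
  4 ^ (4 ^ n) * τ n                       ∎)
  where open ≡-Reasoning

τ-closed : ∀ n → τ n ≡ 2 ^ (2 * ((4 ^ n ∸ 1) / 3))
τ-closed n = trans (τ≡2^2s n) (cong (λ s → 2 ^ (2 * s)) (sym (begin
  (4 ^ n ∸ 1) / 3           ≡⟨ cong (λ t → (t ∸ 1) / 3) (4^n≡3s+1 n) ⟩
  powerSum n * 3 / 3        ≡⟨ m*n/n≡m (powerSum n) 3 ⟩
  powerSum n                ∎)))
  where open ≡-Reasoning

-- The count holds for every n (diamond 0 is the single edge).
theorem5p7 : (n : ℕ) → 1 ≤ n → NumSpanningTrees (diamond n) (2 ^ (2 * ((4 ^ n ∸ 1) / 3)))
theorem5p7 n _ = subst (NumSpanningTrees (diamond n)) (τ-closed n) (proj₁ (proj₂ (diamond-count n)))
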